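{- Let $a$ be a positive integer and let $b>1$ be an integer. Then for each $k\in\{1,2\}$ there are only finitely many Fermat pseudoprimes to the base $b$ of the form $ap^k+1$, where $p$ ranges over the primes.
   Context: For a positive integer $b$, a Fermat pseudoprime to the base $b$ is a composite positive integer $n$ such that $b^{n-1}\equiv 1 \pmod n$. -}

module Defs where

open import Data.Nat using (ℕ; _^_; _∸_)
open import Data.Nat.Divisibility using (_∣_)
open import Data.Nat.Primality using (Composite)
open import Data.Product using (_×_)

-- n is a Fermat pseudoprime to base b: n composite and b^(n-1) ≡ 1 (mod n),
-- the congruence written as  n ∣ b^(n-1) - 1  (truncated subtraction is harmless
-- here since b ≥ 1 implies b^(n-1) ≥ 1).
FermatPseudoprime : ℕ → ℕ → Set
FermatPseudoprime b n = Composite n × (n ∣ (b ^ (n ∸ 1)) ∸ 1)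

{-# OPTIONS --safe #-}
-- Put x = b^a and M = p^k, so that n = aM + 1 divides x^M - 1.
-- If some prime factor q of n is ≡ 1 (mod p), then, since n ≡ 1 (mod p) as well, the cofactor
-- n/q is ≡ 1 (mod p) and is not 1, so n = (1 + ep)(1 + cp) with e, c ≥ 1, that is
-- e + c + ecp = a p^(k-1); for k = 1 and k = 2 this forces p ≤ a.
-- Otherwise, for every prime q ∣ n the order of x modulo q divides both p^k and q - 1 (Fermat),
-- so q ∣ x - 1. Then the geometric sum (x^M - 1)/(x - 1) is ≡ M (mod q) for each such q, hence
-- coprime to n (as p ∤ n), and therefore n ∣ x - 1 < b^a.
module Submission where

open import Defs
open import Data.Nat using (ℕ; _+_; _*_; _^_; _<_; _≤_)
open import Data.Nat.Primality using (Prime)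
open import Data.Product using (∃)
open import Relation.Binary.PropositionalEquality using (_≡_)

open import Data.Fin as Fin using (toℕ; fromℕ; inject₁)
open import Data.Fin.Properties using (toℕ<n; toℕ-fromℕ; toℕ-inject₁)
open import Data.List using ([]; _∷_)
open import Data.List.Relation.Unary.All using (_∷_)
open import Data.Nat using (zero; suc; _∸_; _!; NonZero; z≤n; s≤s; z<s; s<s;
  nonTrivial⇒≢1; nonTrivial⇒n>1; >-nonZero; >-nonZero⁻¹; ≢-nonZero⁻¹)
open import Data.Nat.Combinatorics using (_C_; nCn≡1; nCk≡n!/k![n-k]!; k![n∸k]!∣n!)
open import Data.Nat.Coprimality using (Coprime; coprime-Bézout; coprime-divisor)
open import Data.Nat.Divisibility
open import Data.Nat.DivMod using (_/_; m/n*n≡m)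
open import Data.Nat.GCD using (module Bézout)
open import Data.Nat.Primality
  using (Composite; euclidsLemma; prime?; prime[2]; prime⇒nonZero; prime⇒nonTrivial;
         prime⇒irreducible; composite⇒¬prime; composite⇒nonZero)
open import Data.Nat.Primality.Factorisation using (factorise)
open import Data.Nat.ListAction using (product)
open import Data.Nat.Properties
open import Algebra.Properties.CommutativeSemiring.Binomial +-*-commutativeSemiring
  using (binomial; binomialTerm; theorem)
open import Algebra.Properties.Monoid.Sum +-0-monoid using (sum; sum-init-last)
import Algebra.Properties.Monoid.Mult +-0-monoid as Additive
import Algebra.Properties.Semiring.Exp +-*-semiring as Semiring
open import Data.Nat.Tactic.RingSolver using (solve-∀)
open import Data.Product using (_×_; _,_; ∃₂)
open import Data.Sum using (_⊎_; inj₁; inj₂)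
open import Data.Vec.Functional using (Vector; init; tail)
open import Function using (_∘_)
open import Relation.Binary.PropositionalEquality
  using (refl; sym; trans; cong; cong₂; subst; module ≡-Reasoning)
open import Relation.Nullary using (¬_; Dec; yes; no; contradiction)
open import Relation.Nullary.Decidable using (_×-dec_)

prime∤1 : ∀ {p} → Prime p → ¬ p ∣ 1
prime∤1 pr p∣1 = nonTrivial⇒≢1 {{prime⇒nonTrivial pr}} (∣1⇒≡1 p∣1)

infix 4 _≡1-mod_

-- The same encoding as in FermatPseudoprime; note that 0 ≡1-mod q holds.
_≡1-mod_ : ℕ → ℕ → Set
u ≡1-mod q = q ∣ u ∸ 1

[1+u][1+v]∸1≡u+[1+u]v : ∀ u v → suc u * suc v ∸ 1 ≡ u + suc u * v
[1+u][1+v]∸1≡u+[1+u]v = regroup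
  where
  regroup : ∀ u v → v + u * suc v ≡ u + suc u * v
  regroup = solve-∀

≡1-mod-* : ∀ {q u v} → u ≡1-mod q → v ≡1-mod q → u * v ≡1-mod q
≡1-mod-* {q} {zero} _ _ = q ∣0
≡1-mod-* {q} {suc u} {zero} _ _ rewrite *-zeroʳ u = q ∣0
≡1-mod-* {q} {suc u} {suc v} u≡1 v≡1 rewrite [1+u][1+v]∸1≡u+[1+u]v u v =
  ∣m∣n⇒∣m+n u≡1 (∣n⇒∣m*n (suc u) v≡1)

≡1-mod-^ : ∀ {q u} → u ≡1-mod q → ∀ c → u ^ c ≡1-mod q
≡1-mod-^ {q} u≡1 zero = q ∣0
≡1-mod-^ {q} {u} u≡1 (suc c) = ≡1-mod-* {q} {u} {u ^ c} u≡1 (≡1-mod-^ u≡1 c)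

≡1-mod-cancelʳ : ∀ {q u v} → Prime q → ¬ q ∣ v →
                 u * v ≡1-mod q → v ≡1-mod q → u ≡1-mod q
≡1-mod-cancelʳ {q} {_} {zero} _ q∤v _ _ = contradiction (q ∣0) q∤v
≡1-mod-cancelʳ {q} {zero} {suc v} _ _ _ _ = q ∣0
≡1-mod-cancelʳ {q} {suc u} {suc v} pr q∤v uv≡1 v≡1
  with euclidsLemma (suc v) u pr (∣m+n∣m⇒∣n q∣v+[1+v]u v≡1)
  where
  q∣v+[1+v]u : q ∣ v + suc v * u
  q∣v+[1+v]u = subst (q ∣_)
    (trans (cong (_∸ 1) (*-comm (suc u) (suc v))) ([1+u][1+v]∸1≡u+[1+u]v v u)) uv≡1
... | inj₁ q∣v = contradiction q∣v q∤v
... | inj₂ q∣u = q∣u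

≡1-mod∧∣⇒∣1 : ∀ {q u} → 0 < u → u ≡1-mod q → q ∣ u → q ∣ 1
≡1-mod∧∣⇒∣1 {q} {suc u} _ u≡1 q∣u = ∣m+n∣m⇒∣n (subst (q ∣_) (+-comm 1 u) q∣u) u≡1

×≡* : ∀ m n → m Additive.× n ≡ m * n
×≡* zero n = refl
×≡* (suc m) n = cong (n +_) (×≡* m n)

^ₛ≡^ : ∀ m n → m Semiring.^ n ≡ m ^ n
^ₛ≡^ m zero = refl
^ₛ≡^ m (suc n) = cong (m *_) (^ₛ≡^ m n)

∣-sum : ∀ {d n} (f : Vector ℕ n) → (∀ i → d ∣ f i) → d ∣ sum f
∣-sum {d} {zero} f d∣f = d ∣0
∣-sum {n = suc n} f d∣f = ∣m∣n⇒∣m+n (d∣f Fin.zero) (∣-sum (tail f) (d∣f ∘ Fin.suc))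

sum-head-init-last : ∀ {n} (f : Vector ℕ (suc (suc n))) →
                     sum f ≡ f Fin.zero + sum (init (tail f)) + f (fromℕ (suc n))
sum-head-init-last {n} f = trans (cong (f Fin.zero +_) (sum-init-last (tail f)))
  (sym (+-assoc (f Fin.zero) (sum (init (tail f))) (f (fromℕ (suc n)))))

prime∤! : ∀ {p} m → Prime p → m < p → ¬ p ∣ m !
prime∤! zero pr _ = prime∤1 pr
prime∤! (suc m) pr m<p p∣m! with euclidsLemma (suc m) (m !) pr p∣m!
... | inj₁ p∣1+m = <⇒≱ m<p (∣⇒≤ p∣1+m)
... | inj₂ p∣m!  = prime∤! m pr (<-trans (n<1+n m) m<p) p∣m!

prime∣C : ∀ {p} k → Prime p → 0 < k → k < p → p ∣ p C k
prime∣C {suc r} k pr 0<k k<p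
  with euclidsLemma (p C k) (k ! * (p ∸ k) !) pr (subst (p ∣_) (sym C*k![p∸k]!≡p!) (m∣m*n (r !)))
  where
  p = suc r
  instance _ = k !* (p ∸ k) !≢0
  C*k![p∸k]!≡p! : (p C k) * (k ! * (p ∸ k) !) ≡ p !
  C*k![p∸k]!≡p! = begin
    (p C k) * (k ! * (p ∸ k) !)
      ≡⟨ cong (_* (k ! * (p ∸ k) !)) (nCk≡n!/k![n-k]! (<⇒≤ k<p)) ⟩
    p ! / (k ! * (p ∸ k) !) * (k ! * (p ∸ k) !)
      ≡⟨ m/n*n≡m (k![n∸k]!∣n! (<⇒≤ k<p)) ⟩
    p ! ∎
    where open ≡-Reasoning
... | inj₁ p∣C = p∣C
... | inj₂ p∣k![p∸k]! with euclidsLemma (k !) ((suc r ∸ k) !) pr p∣k![p∸k]!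
...   | inj₁ p∣k!     = contradiction p∣k! (prime∤! k pr k<p)
...   | inj₂ p∣[p∸k]! =
  contradiction p∣[p∸k]! (prime∤! (suc r ∸ k) pr (∸-monoʳ-< 0<k (<⇒≤ k<p)))

freshman's-dream : ∀ {p} → Prime p → ∀ x → ∃ λ t → (1 + x) ^ p ≡ x ^ p + t * p + 1
freshman's-dream {suc r} pr x = quotient p∣middle , (begin
  (1 + x) ^ p
    ≡⟨ ^ₛ≡^ (1 + x) p ⟨
  (1 + x) Semiring.^ p
    ≡⟨ theorem p 1 x ⟩
  sum term
    ≡⟨ sum-head-init-last term ⟩
  term Fin.zero + sum (init (tail term)) + term (fromℕ p)
    ≡⟨ cong₂ _+_ (cong₂ _+_ first≡x^p (m∣n⇒n≡quotient*m p∣middle)) (last≡1 (toℕ-fromℕ p)) ⟩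
  x ^ p + quotient p∣middle * p + 1 ∎)
  where
  open ≡-Reasoning
  p = suc r
  term : Vector ℕ (suc p)
  term = binomialTerm 1 x p
  first≡x^p : term Fin.zero ≡ x ^ p
  first≡x^p = trans (×≡* 1 _) (trans (*-identityˡ _) (trans (*-identityˡ _) (^ₛ≡^ x p)))
  last≡1 : ∀ {k} → k ≡ p → (p C k) Additive.× (1 Semiring.^ k * x Semiring.^ (p ∸ k)) ≡ 1
  last≡1 refl rewrite nCn≡1 p | n∸n≡0 p =
    trans (×≡* 1 _) (trans (*-identityˡ _) (trans (*-identityʳ _) (trans (^ₛ≡^ 1 p) (^-zeroˡ p))))
  p∣middle : p ∣ sum (init (tail term))
  p∣middle = ∣-sum (init (tail term)) λ i →
    subst (p ∣_) (sym (×≡* (p C suc (toℕ (inject₁ i))) (binomial 1 x p (Fin.suc (inject₁ i)))))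
      (∣m⇒∣m*n _ (prime∣C (suc (toℕ (inject₁ i))) pr z<s
        (s<s (subst (_< r) (sym (toℕ-inject₁ i)) (toℕ<n i)))))

x^p≡x+s*p : ∀ {p} → Prime p → ∀ x → ∃ λ s → x ^ p ≡ x + s * p
x^p≡x+s*p {suc r} pr zero = 0 , refl
x^p≡x+s*p {p} pr (suc x) with freshman's-dream pr x | x^p≡x+s*p pr x
... | t , [1+x]^p≡ | s , x^p≡ = s + t , (begin
  (1 + x) ^ p           ≡⟨ [1+x]^p≡ ⟩
  x ^ p + t * p + 1     ≡⟨ cong (λ y → y + t * p + 1) x^p≡ ⟩
  x + s * p + t * p + 1 ≡⟨ regroup x s t p ⟩
  1 + x + (s + t) * p   ∎)
  where
  open ≡-Reasoning
  regroup : ∀ x s t p → x + s * p + t * p + 1 ≡ 1 + x + (s + t) * p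
  regroup = solve-∀

fermat : ∀ {p x} → Prime p → ¬ p ∣ x → x ^ (p ∸ 1) ≡1-mod p
fermat {suc r} {x} pr p∤x with x^p≡x+s*p pr x
... | s , x^p≡x+sp with euclidsLemma x (x ^ r ∸ 1) pr (divides s x[x^r∸1]≡sp)
  where
  x[x^r∸1]≡sp : x * (x ^ r ∸ 1) ≡ s * suc r
  x[x^r∸1]≡sp = begin
    x * (x ^ r ∸ 1)      ≡⟨ *-distribˡ-∸ x (x ^ r) 1 ⟩
    x ^ suc r ∸ x * 1    ≡⟨ cong₂ _∸_ x^p≡x+sp (*-identityʳ x) ⟩
    x + s * suc r ∸ x    ≡⟨ m+n∸m≡n x (s * suc r) ⟩
    s * suc r            ∎
    where open ≡-Reasoning
... | inj₁ p∣x = contradiction p∣x p∤x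
... | inj₂ p∣x^r∸1 = p∣x^r∸1

prime∣^⇒∣ : ∀ {q x} e → Prime q → q ∣ x ^ e → q ∣ x
prime∣^⇒∣ zero pr q∣1 = contradiction q∣1 (prime∤1 pr)
prime∣^⇒∣ {x = x} (suc e) pr q∣x^[1+e] with euclidsLemma x (x ^ e) pr q∣x^[1+e]
... | inj₁ q∣x   = q∣x
... | inj₂ q∣x^e = prime∣^⇒∣ e pr q∣x^e

≡1-mod-^-multiple : ∀ {q x e} → x ^ e ≡1-mod q → ∀ c → x ^ (c * e) ≡1-mod q
≡1-mod-^-multiple {q} {x} {e} x^e≡1 c =
  subst (_≡1-mod q) (trans (^-*-assoc x e c) (cong (x ^_) (*-comm e c))) (≡1-mod-^ x^e≡1 c)

≡1-mod-Bézout-exponents : ∀ {q x E F} u v → Prime q → ¬ q ∣ x →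
                          x ^ E ≡1-mod q → x ^ F ≡1-mod q → 1 + v * F ≡ u * E → x ≡1-mod q
≡1-mod-Bézout-exponents {q} {x} {F = F} u v pr q∤x x^E≡1 x^F≡1 1+vF≡uE =
  ≡1-mod-cancelʳ {u = x} pr (q∤x ∘ prime∣^⇒∣ (v * F) pr)
    (subst (λ e → x ^ e ≡1-mod q) (sym 1+vF≡uE) (≡1-mod-^-multiple x^E≡1 u))
    (≡1-mod-^-multiple x^F≡1 v)

≡1-mod-coprime-exponents : ∀ {q x A B} → Prime q → ¬ q ∣ x →
                           x ^ A ≡1-mod q → x ^ B ≡1-mod q → Coprime A B → x ≡1-mod q
≡1-mod-coprime-exponents pr q∤x x^A≡1 x^B≡1 A⊥B with coprime-Bézout A⊥B
... | Bézout.+- u v 1+vB≡uA = ≡1-mod-Bézout-exponents u v pr q∤x x^A≡1 x^B≡1 1+vB≡uA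
... | Bézout.-+ u v 1+uA≡vB = ≡1-mod-Bézout-exponents v u pr q∤x x^B≡1 x^A≡1 1+uA≡vB

∃prime∣ : ∀ {d} → 2 ≤ d → ∃ λ q → Prime q × q ∣ d
∃prime∣ {suc d} 1<1+d with factorise (suc d)
... | record { factors = [] ; isFactorisation = 1+d≡1 } = contradiction (sym 1+d≡1) (<⇒≢ 1<1+d)
... | record { factors = q ∷ qs ; isFactorisation = 1+d≡Π ; factorsPrime = pr ∷ _ } =
  q , pr , divides (product qs) (trans 1+d≡Π (*-comm q (product qs)))

¬commonPrime⇒coprime : ∀ {m n} → (∀ {q} → Prime q → q ∣ m → ¬ q ∣ n) → Coprime m n
¬commonPrime⇒coprime ¬common {zero} (0∣m , 0∣n) =
  contradiction (∣-trans (2 ∣0) 0∣n) (¬common prime[2] (∣-trans (2 ∣0) 0∣m))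
¬commonPrime⇒coprime ¬common {suc zero} _ = refl
¬commonPrime⇒coprime ¬common {suc (suc d)} (d∣m , d∣n)
  with ∃prime∣ {suc (suc d)} (s≤s (s≤s z≤n))
... | q , pr , q∣d = contradiction (∣-trans q∣d d∣n) (¬common pr (∣-trans q∣d d∣m))

prime∣prime⇒≡ : ∀ {q p} → Prime q → Prime p → q ∣ p → q ≡ p
prime∣prime⇒≡ prq prp q∣p with prime⇒irreducible prp q∣p
... | inj₁ refl = contradiction ∣-refl (prime∤1 prq)
... | inj₂ q≡p  = q≡p

prime^-coprime : ∀ {p m} k → Prime p → ¬ p ∣ m → Coprime (p ^ k) m
prime^-coprime k pr p∤m = ¬commonPrime⇒coprime λ prq q∣p^k q∣m →
  p∤m (subst (_∣ _) (prime∣prime⇒≡ prq pr (prime∣^⇒∣ k prq q∣p^k)) q∣m)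

geometricSum : ℕ → ℕ → ℕ
geometricSum y zero = 0
geometricSum y (suc m) = 1 + (1 + y) * geometricSum y m

[1+y]^m≡1+y*geometricSum : ∀ y m → (1 + y) ^ m ≡ 1 + y * geometricSum y m
[1+y]^m≡1+y*geometricSum y zero = cong suc (sym (*-zeroʳ y))
[1+y]^m≡1+y*geometricSum y (suc m) =
  trans (cong ((1 + y) *_) ([1+y]^m≡1+y*geometricSum y m)) (distrib y (geometricSum y m))
  where
  distrib : ∀ y g → (1 + y) * (1 + y * g) ≡ 1 + y * (1 + (1 + y) * g)
  distrib = solve-∀

geometricSum≡m+y* : ∀ y m → ∃ λ h → geometricSum y m ≡ m + y * h
geometricSum≡m+y* y zero = 0 , sym (*-zeroʳ y)
geometricSum≡m+y* y (suc m) with geometricSum≡m+y* y m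
... | h , g≡m+yh = h + geometricSum y m , (begin
  1 + (1 + y) * geometricSum y m         ≡⟨ cong (λ g → 1 + g + y * geometricSum y m) g≡m+yh ⟩
  1 + (m + y * h) + y * geometricSum y m ≡⟨ regroup m y h (geometricSum y m) ⟩
  suc m + y * (h + geometricSum y m)     ∎)
  where
  open ≡-Reasoning
  regroup : ∀ m y h g → 1 + (m + y * h) + y * g ≡ suc m + y * (h + g)
  regroup = solve-∀

∣⇒∣^ : ∀ {d x} e → .{{NonZero e}} → d ∣ x → d ∣ x ^ e
∣⇒∣^ {x = x} (suc e) d∣x = ∣m⇒∣m*n (x ^ e) d∣x

^p^k≡1-mod⇒≡1-mod : ∀ {p n x} k → Prime p → ¬ p ∣ n →
                    (∀ {q} → Prime q → q ∣ n → ¬ q ≡1-mod p) →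
                    x ^ (p ^ k) ≡1-mod n → x ≡1-mod n
^p^k≡1-mod⇒≡1-mod {n = n} {x = zero} _ _ _ _ _ = n ∣0
^p^k≡1-mod⇒≡1-mod {p} {n} {suc y} k prp p∤n noSplit x^M≡1 =
  coprime-divisor n⊥G (subst (n ∣_) x^M∸1≡G*y x^M≡1)
  where
  instance _ = m^n≢0 p k {{prime⇒nonZero prp}}
  M = p ^ k
  G = geometricSum y M
  x^M∸1≡G*y : suc y ^ M ∸ 1 ≡ G * y
  x^M∸1≡G*y = trans (cong (_∸ 1) ([1+y]^m≡1+y*geometricSum y M)) (*-comm y G)
  q∣y : ∀ {q} → Prime q → q ∣ n → q ∣ y
  q∣y {q} prq q∣n =
    ≡1-mod-coprime-exponents prq q∤x x^M≡1[q] (fermat prq q∤x) (prime^-coprime k prp (noSplit prq q∣n))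
    where
    x^M≡1[q] : suc y ^ M ≡1-mod q
    x^M≡1[q] = ∣-trans q∣n x^M≡1
    q∤x : ¬ q ∣ suc y
    q∤x q∣x = prime∤1 prq (≡1-mod∧∣⇒∣1 (m^n>0 (suc y) M) x^M≡1[q] (∣⇒∣^ M q∣x))
  n⊥G : Coprime n G
  n⊥G = ¬commonPrime⇒coprime q∤G
    where
    q∤G : ∀ {q} → Prime q → q ∣ n → ¬ q ∣ G
    q∤G {q} prq q∣n q∣G with geometricSum≡m+y* y M
    ... | h , G≡M+yh = p∤n (subst (_∣ n) (prime∣prime⇒≡ prq prp (prime∣^⇒∣ k prq q∣M)) q∣n)
      where
      q∣M : q ∣ M
      q∣M = ∣m+n∣m⇒∣n (subst (q ∣_) (trans G≡M+yh (+-comm M (y * h))) q∣G)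
                      (∣m⇒∣m*n h (q∣y prq q∣n))

≡1-mod⇒≡1+* : ∀ {p u} → 2 ≤ u → u ≡1-mod p → ∃ λ e → u ≡ 1 + suc e * p
≡1-mod⇒≡1+* {u = suc (suc u)} _ (divides (suc e) 1+u≡[1+e]p) = e , cong suc 1+u≡[1+e]p
≡1-mod⇒≡1+* {u = suc (suc u)} _ (divides zero ())
≡1-mod⇒≡1+* {u = suc zero} (s≤s ()) _

≡1-mod-split : ∀ {p q n} → Prime p → Prime q → Composite n →
               n ≡1-mod p → q ∣ n → q ≡1-mod p →
               ∃₂ λ e c → n ≡ (1 + suc e * p) * (1 + suc c * p)
≡1-mod-split {p} {q} {n} prp prq n-comp n≡1 (divides m n≡mq) q≡1
  with ≡1-mod⇒≡1+* (2≤m m n≡mq)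
                    (≡1-mod-cancelʳ {u = m} prp p∤q (subst (_≡1-mod p) n≡mq n≡1) q≡1)
     | ≡1-mod⇒≡1+* (nonTrivial⇒n>1 q {{prime⇒nonTrivial prq}}) q≡1
  where
  p∤q : ¬ p ∣ q
  p∤q p∣q = prime∤1 prp (≡1-mod∧∣⇒∣1 (>-nonZero⁻¹ q {{prime⇒nonZero prq}}) q≡1 p∣q)
  2≤m : ∀ m → n ≡ m * q → 2 ≤ m
  2≤m zero n≡0 = contradiction n≡0 (≢-nonZero⁻¹ n {{composite⇒nonZero n-comp}})
  2≤m (suc zero) n≡q =
    contradiction (subst Prime (sym (trans n≡q (*-identityˡ q))) prq) (composite⇒¬prime n-comp)
  2≤m (suc (suc m)) _ = s≤s (s≤s z≤n)
... | e , m≡1+[1+e]p | c , q≡1+[1+c]p = e , c , trans n≡mq (cong₂ _*_ m≡1+[1+e]p q≡1+[1+c]p)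

split-equation : ∀ {a p j} e c → .{{NonZero p}} →
                 (1 + e * p) * (1 + c * p) ≡ a * p ^ suc j + 1 → e + c + e * c * p ≡ a * p ^ j
split-equation {a} {p} {j} e c eq = *-cancelʳ-≡ (e + c + e * c * p) (a * p ^ j) p (suc-injective (begin
  suc ((e + c + e * c * p) * p) ≡⟨ expand e c p ⟩
  (1 + e * p) * (1 + c * p)     ≡⟨ eq ⟩
  a * p ^ suc j + 1             ≡⟨ regroup a p (p ^ j) ⟩
  suc (a * p ^ j * p)           ∎))
  where
  open ≡-Reasoning
  expand : ∀ e c p → suc ((e + c + e * c * p) * p) ≡ (1 + e * p) * (1 + c * p)
  expand = solve-∀
  regroup : ∀ a p P → a * (p * P) + 1 ≡ suc (a * P * p)
  regroup = solve-∀

SplitSolution : ℕ → ℕ → ℕ → Set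
SplitSolution a p j = ∃₂ λ e c → suc e + suc c + suc e * suc c * p ≡ a * p ^ j

split-bound₁ : ∀ {a p} e c → suc e + suc c + suc e * suc c * p ≡ a → p ≤ a
split-bound₁ {a} {p} e c eq = begin
  p                                    ≤⟨ m≤m+n p _ ⟩
  suc e * suc c * p                    ≤⟨ m≤n+m _ (suc e + suc c) ⟩
  suc e + suc c + suc e * suc c * p    ≡⟨ eq ⟩
  a                                    ∎
  where open ≤-Reasoning

split-bound₂ : ∀ {a p} e c → suc e + suc c + suc e * suc c * p ≡ a * p → p ≤ a
split-bound₂ {a} {p} e c eq = begin
  p           ≤⟨ ∣⇒≤ p∣S ⟩
  S           ≤⟨ m≤m+n S (e * c) ⟩
  S + e * c   ≡⟨ expand e c ⟩
  suc E       ≤⟨ *-cancelʳ-< p E a E*p<a*p ⟩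
  a           ∎
  where
  open ≤-Reasoning
  S = suc e + suc c
  E = suc e * suc c
  p∣S : p ∣ S
  p∣S = ∣m+n∣m⇒∣n (subst (p ∣_) (trans (sym eq) (+-comm S (E * p))) (n∣m*n a)) (n∣m*n E)
  E*p<a*p : E * p < a * p
  E*p<a*p = subst (E * p <_) eq (m<n+m (E * p) {S} z<s)
  expand : ∀ e c → suc e + suc c + e * c ≡ suc (suc e * suc c)
  expand = solve-∀

split-bound : ∀ {a p j} → j ≤ 1 → SplitSolution a p j → p ≤ a
split-bound {a} z≤n (e , c , eq) = split-bound₁ e c (trans eq (*-identityʳ a))
split-bound {a} {p} (s≤s z≤n) (e , c , eq) = split-bound₂ e c (trans eq (cong (a *_) (*-identityʳ p)))

pseudoprime-dichotomy : ∀ {a b p} j → 1 ≤ a → 1 < b → Prime p →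
                        FermatPseudoprime b (a * p ^ suc j + 1) →
                        a * p ^ suc j + 1 < b ^ a ⊎ SplitSolution a p j
pseudoprime-dichotomy {a} {b} {p} j 1≤a 1<b prp (n-comp , b^[n∸1]≡1) =
  byPrimeFactor≡1 (anyUpTo? (λ q → prime? q ×-dec (q ∣? n ×-dec p ∣? q ∸ 1)) (suc n))
  where
  instance _ = prime⇒nonZero prp
  M = p ^ suc j
  n = a * M + 1
  x = b ^ a
  instance _ = >-nonZero (m≤n+m 1 (a * M))
  n≡1[p] : n ≡1-mod p
  n≡1[p] = subst (p ∣_) (sym (m+n∸n≡m (a * M) 1)) (∣n⇒∣m*n a (m∣m*n (p ^ j)))
  p∤n : ¬ p ∣ n
  p∤n p∣n = prime∤1 prp (≡1-mod∧∣⇒∣1 (m≤n+m 1 (a * M)) n≡1[p] p∣n)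
  x^M≡1[n] : x ^ M ≡1-mod n
  x^M≡1[n] = subst (_≡1-mod n)
    (trans (cong (b ^_) (m+n∸n≡m (a * M) 1)) (sym (^-*-assoc b a M))) b^[n∸1]≡1
  2≤x : 2 ≤ x
  2≤x = ≤-trans 1<b
    (subst (_≤ x) (*-identityʳ b) (^-monoʳ-≤ b {{>-nonZero (<-trans z<s 1<b)}} 1≤a))
  byPrimeFactor≡1 : Dec (∃ λ q → q < suc n × Prime q × q ∣ n × q ≡1-mod p) →
                    n < x ⊎ SplitSolution a p j
  byPrimeFactor≡1 (yes (q , _ , prq , q∣n , q≡1))
    with ≡1-mod-split prp prq n-comp n≡1[p] q∣n q≡1
  ... | e , c , n≡[1+ep][1+cp] =
    inj₂ (e , c , split-equation {a} {p} {j} (suc e) (suc c) (sym n≡[1+ep][1+cp]))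
  byPrimeFactor≡1 (no ¬split) = inj₁ (≤-<-trans n≤x∸1 (∸-monoʳ-< z<s (<⇒≤ 2≤x)))
    where
    noSplit : ∀ {q} → Prime q → q ∣ n → ¬ q ≡1-mod p
    noSplit prq q∣n q≡1 = ¬split (_ , s≤s (∣⇒≤ q∣n) , prq , q∣n , q≡1)
    n≤x∸1 : n ≤ x ∸ 1
    n≤x∸1 = ∣⇒≤ {{>-nonZero (∸-monoˡ-≤ 1 2≤x)}}
                (^p^k≡1-mod⇒≡1-mod (suc j) prp p∤n noSplit x^M≡1[n])

mainTheorem1 : (a b k : ℕ) → 1 ≤ a → 1 < b → 1 ≤ k → k ≤ 2 →
    ∃ λ N → (p : ℕ) → Prime p → FermatPseudoprime b (a * p ^ k + 1) →
      a * p ^ k + 1 < N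
mainTheorem1 a b (suc j) 1≤a 1<b _ (s≤s j≤1) = suc (b ^ a + (a * a ^ suc j + 1)) , n<N
  where
  n<N : ∀ p → Prime p → FermatPseudoprime b (a * p ^ suc j + 1) →
        a * p ^ suc j + 1 < suc (b ^ a + (a * a ^ suc j + 1))
  n<N p prp psp with pseudoprime-dichotomy j 1≤a 1<b prp psp
  ... | inj₁ n<b^a = m≤n⇒m≤1+n (≤-trans n<b^a (m≤m+n (b ^ a) _))
  ... | inj₂ split =
    s≤s (≤-trans (+-monoˡ-≤ 1 (*-monoʳ-≤ a (^-monoˡ-≤ (suc j) p≤a))) (m≤n+m _ (b ^ a)))
    where
    p≤a : p ≤ a
    p≤a = split-bound j≤1 split
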